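{- For all integers $n_1\geq 3$ and $n_2\geq 0$, \[ \ell(n_1)\cdot g(n_2)\geq \ell(n_1+n_2). \]
   Context: $f(n)$ denotes the $n$th Fibonacci number: $f(0)=0$, $f(1)=1$, $f(n)=f(n-1)+f(n-2)$ for $n\ge 2$. For $n\ge 0$, $g(n)=f(n+2)$; for $n\geq 3$, $\ell(n)=f(n+2)-f(n-3)$. -}

module Defs where

open import Data.Nat using (ℕ; zero; suc; _+_; _∸_)

f : ℕ → ℕ
f zero = 0
f (suc zero) = 1
f (suc (suc n)) = f (suc n) + f n

g : ℕ → ℕ
g n = f (n + 2)

-- ℓ(n) = f(n+2) - f(n-3); only meaningful for n ≥ 3, where f(n+2) ≥ f(n-3),
-- so truncated subtraction agrees with integer subtraction.
ℓ : ℕ → ℕ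
ℓ n = f (n + 2) ∸ f (n ∸ 3)

-- Writing ℓ (3 + j) = 5 f (j + 1) + 2 f j shows that n ↦ ℓ (3 + n) satisfies the Fibonacci
-- recurrence and at most doubles at each step. For any such sequence u the bound
-- u (k + m) ≤ u m * f (k + 2) follows by induction on k, since f (k + 2) obeys the same recurrence.
module Submission where

open import Defs
open import Data.Nat using (ℕ; zero; suc; _+_; _*_; _≤_; _≥_; _≤?_; s≤s)
open import Data.Nat.Properties
open import Data.Nat.Tactic.RingSolver using (solve-∀)
open import Relation.Binary.PropositionalEquality using (_≡_; cong; cong₂; sym)
open import Relation.Nullary.Decidable using (from-yes)

record FibonacciLike (u : ℕ → ℕ) : Set where
  constructor fibonacciLike
  field
    recurrence : ∀ n → u (suc (suc n)) ≡ u (suc n) + u n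

module _ {u : ℕ → ℕ} (u-fib : FibonacciLike u) where

  open FibonacciLike u-fib

  fibonacciLike-monotone : u 0 ≤ u 1 → ∀ n → u n ≤ u (suc n)
  fibonacciLike-monotone u₀≤u₁ zero    = u₀≤u₁
  fibonacciLike-monotone u₀≤u₁ (suc n) = ≤-trans (m≤m+n (u (suc n)) (u n)) (≤-reflexive (sym (recurrence n)))

  fibonacciLike-doubling : u 0 ≤ u 1 → u 1 ≤ u 0 * 2 → ∀ n → u (suc n) ≤ u n * 2
  fibonacciLike-doubling u₀≤u₁ u₁≤2u₀ zero    = u₁≤2u₀
  fibonacciLike-doubling u₀≤u₁ u₁≤2u₀ (suc n) = begin
    u (suc (suc n))         ≡⟨ recurrence n ⟩
    u (suc n) + u n         ≤⟨ +-monoʳ-≤ (u (suc n)) (fibonacciLike-monotone u₀≤u₁ n) ⟩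
    u (suc n) + u (suc n)   ≡⟨ x+x≡x*2 (u (suc n)) ⟩
    u (suc n) * 2           ∎
    where
    open ≤-Reasoning
    x+x≡x*2 : ∀ x → x + x ≡ x * 2
    x+x≡x*2 = solve-∀

  -- f 3 reduces to 2, so the case k = 1 is exactly the hypothesis.
  fibonacciLike-≤-*-f : u 1 ≤ u 0 * 2 → ∀ k → u k ≤ u 0 * f (suc (suc k))
  fibonacciLike-≤-*-f u₁≤2u₀ zero          = ≤-reflexive (sym (*-identityʳ (u 0)))
  fibonacciLike-≤-*-f u₁≤2u₀ (suc zero)    = u₁≤2u₀
  fibonacciLike-≤-*-f u₁≤2u₀ (suc (suc k)) = begin
    u (suc (suc k))                                       ≡⟨ recurrence k ⟩
    u (suc k) + u k                                       ≤⟨ +-mono-≤ (fibonacciLike-≤-*-f u₁≤2u₀ (suc k))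
                                                                       (fibonacciLike-≤-*-f u₁≤2u₀ k) ⟩
    u 0 * f (suc (suc (suc k))) + u 0 * f (suc (suc k))   ≡⟨ sym (*-distribˡ-+ (u 0) _ _) ⟩
    u 0 * f (suc (suc (suc (suc k))))                     ∎
    where open ≤-Reasoning

fibonacciLike-shift : ∀ {u} → FibonacciLike u → ∀ m → FibonacciLike (λ k → u (k + m))
fibonacciLike-shift u-fib m = fibonacciLike λ k → FibonacciLike.recurrence u-fib (k + m)

ℓ₃ : ℕ → ℕ
ℓ₃ j = 5 * f (suc j) + 2 * f j

ℓ₃-fibonacciLike : FibonacciLike ℓ₃
ℓ₃-fibonacciLike = fibonacciLike λ n → identity (f (suc n)) (f n)
  where
  identity : ∀ a b → 5 * ((a + b) + a) + 2 * (a + b) ≡ (5 * (a + b) + 2 * a) + (5 * a + 2 * b)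
  identity = solve-∀

f+5≡ℓ₃+f : ∀ j → f (suc (suc (suc (suc (suc j))))) ≡ ℓ₃ j + f j
f+5≡ℓ₃+f j = identity (f (suc j)) (f j)
  where
  identity : ∀ a b → (((a + b) + a) + (a + b)) + ((a + b) + a) ≡ (5 * a + 2 * b) + b
  identity = solve-∀

ℓ-3+≡ℓ₃ : ∀ j → ℓ (3 + j) ≡ ℓ₃ j
ℓ-3+≡ℓ₃ j rewrite +-comm j 2 | f+5≡ℓ₃+f j = m+n∸n≡m (ℓ₃ j) (f j)

ℓ₃-doubling : ∀ n → ℓ₃ (suc n) ≤ ℓ₃ n * 2
ℓ₃-doubling = fibonacciLike-doubling ℓ₃-fibonacciLike (from-yes (5 ≤? 7)) (from-yes (7 ≤? 10))

lemma6 : (n₁ n₂ : ℕ) → n₁ ≥ 3 → ℓ n₁ * g n₂ ≥ ℓ (n₁ + n₂)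
lemma6 (suc (suc (suc m))) n₂ (s≤s (s≤s (s≤s _))) = begin
  ℓ (3 + (m + n₂))        ≡⟨ ℓ-3+≡ℓ₃ (m + n₂) ⟩
  ℓ₃ (m + n₂)             ≡⟨ cong ℓ₃ (+-comm m n₂) ⟩
  ℓ₃ (n₂ + m)             ≤⟨ fibonacciLike-≤-*-f (fibonacciLike-shift ℓ₃-fibonacciLike m) (ℓ₃-doubling m) n₂ ⟩
  ℓ₃ m * f (2 + n₂)       ≡⟨ cong₂ _*_ (sym (ℓ-3+≡ℓ₃ m)) (cong f (+-comm 2 n₂)) ⟩
  ℓ (3 + m) * g n₂        ∎
  where open ≤-Reasoning
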